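{- Let $D=(E,\mathcal F)$ be a vf-safe delta-matroid. Then $D$ is connected if and only if the multimatroid $Q_3(D)$ is connected.
   Context: A delta-matroid $D=(E,\mathcal F)$ is a finite set $E$ with a non-empty family $\mathcal F$ of subsets (feasible sets) such that for all $F_1,F_2\in\mathcal F$ and $x\in F_1\triangle F_2$ there is $y\in F_1\triangle F_2$ (possibly $y=x$) with $F_1\triangle\{x,y\}\in\mathcal F$. The direct sum of $(E_1,\mathcal F_1)$, $(E_2,\mathcal F_2)$ with disjoint ground sets is $(E_1\cup E_2,\{F_1\cup F_2:F_i\in\mathcal F_i\})$; $D$ is connected if it is not a direct sum of two delta-matroids with non-empty ground sets. For a set system $D=(E,\mathcal F)$ and $A\subseteq E$: the twist is $D*A=(E,\{F\triangle A:F\in\mathcal F\})$; for $e\in E$, $D+e=(E,\mathcal F\triangle\{F\cup e:F\in\mathcal F, e\notin F\})$, and $D+A=D+a_1+\cdots+a_n$ for $A=\{a_1,\dots,a_n\}$ (order irrelevant). $D$ is vf-safe if every sequence of twists and loop complementations applied to $D$ yields a delta-matroid. Write $D\bar*A=((D+A)*A)+A$. Let $E_0=E$, $E_1=\{e':e\in E\}$, $E_2=\{e'':e\in E\}$ (disjoint copies), $U=E_0\cup E_1\cup E_2$, $\Omega=\{\{e,e',e''\}:e\in E\}$, and let $\pi$ map subsets of $U$ to subsets of $E$ by $e,e',e''\mapsto e$. $Q_3(D)$ is the multimatroid on $U$ with skew classes $\Omega$ whose bases are exactly the transversals $B$ of $\Omega$ (sets meeting each skew class once) such that $\pi(B\cap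 E_1)$ is feasible in $D\bar*\pi(B\cap E_2)$; its rank function is $r(S)=\max_B|S\cap B|$ over bases $B$, for subtransversals $S$ (sets meeting each skew class at most once). (It is known that for vf-safe $D$ this is a tight 3-matroid.) A multimatroid with rank function $r$ is connected if there is no union $X$ of skew classes with $\emptyset\ne X\ne U$ such that $r(S)=r(S\cap X)+r(S-X)$ for every subtransversal $S$. -}

module Defs where

open import Data.Bool using (Bool; true; false; _xor_; _∧_; if_then_else_)
open import Data.Nat using (ℕ; zero; suc; _+_; _⊔_)
open import Data.Fin using (Fin; _≟_)
import Data.Fin
import Data.Bool
open import Data.Fin.Subset using (Subset; _∈_; _∪_; _⊆_; ∁; ⁅_⁆; Nonempty; _-_)
open import Data.Vec using (Vec; []; _∷_; zipWith; lookup; map)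
open import Data.List using (List; []; _∷_; foldr; allFin; concatMap; filter)
import Data.List as L
open import Data.Maybe using (Maybe; just; nothing)
open import Data.Product using (Σ; ∃; ∃-syntax; _×_; _,_)
open import Relation.Nullary using (¬_)
open import Relation.Nullary.Decidable using (⌊_⌋)
open import Relation.Binary.PropositionalEquality using (_≡_)
open import Function.Bundles using (_⇔_)

-- Ground set E = Fin n; subsets of E are Subset n (= Vec Bool n).
-- A set system on E is given by its (decidable) characteristic function:
-- X is feasible iff F X ≡ true.
SetSystem : ℕ → Set
SetSystem n = Subset n → Bool

Feasible : ∀ {n} → SetSystem n → Subset n → Set
Feasible F X = F X ≡ true

_△_ : ∀ {n} → Subset n → Subset n → Subset n
X △ Y = zipWith _xor_ X Y

IsDeltaMatroid : ∀ {n} → SetSystem n → Set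
IsDeltaMatroid {n} F =
  (∃[ X ] Feasible F X) ×
  (∀ (F₁ F₂ : Subset n) → Feasible F F₁ → Feasible F F₂ →
     ∀ (x : Fin n) → x ∈ (F₁ △ F₂) →
       ∃[ y ] (y ∈ (F₁ △ F₂) × Feasible F (F₁ △ (⁅ x ⁆ ∪ ⁅ y ⁆))))

twist : ∀ {n} → SetSystem n → Subset n → SetSystem n
twist F A X = F (X △ A)

-- loop complementation D + e :
-- family F △ { X ∪ e : X ∈ F, e ∉ X }
loopc : ∀ {n} → SetSystem n → Fin n → SetSystem n
loopc F e X = F X xor (lookup X e ∧ F (X - e))

loopcSet : ∀ {n} → SetSystem n → Subset n → SetSystem n
loopcSet {n} F A = foldr step F (allFin n)
  where
  step : Fin n → SetSystem n → SetSystem n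
  step e G = if lookup A e then loopc G e else G

barTwist : ∀ {n} → SetSystem n → Subset n → SetSystem n
barTwist F A = loopcSet (twist (loopcSet F A) A) A

data Op (n : ℕ) : Set where
  tw : Subset n → Op n
  lc : Fin n → Op n

applyOp : ∀ {n} → Op n → SetSystem n → SetSystem n
applyOp (tw A) F = twist F A
applyOp (lc e) F = loopc F e

applyOps : ∀ {n} → List (Op n) → SetSystem n → SetSystem n
applyOps ops F = foldr applyOp F ops

VFSafe : ∀ {n} → SetSystem n → Set
VFSafe F = ∀ ops → IsDeltaMatroid (applyOps ops F)

IsDirectSumSplit : ∀ {n} → SetSystem n → Set
IsDirectSumSplit {n} F =
  Σ (Subset n) λ P → Nonempty P × Nonempty (∁ P) ×
  Σ (SetSystem n) λ F₁ → Σ (SetSystem n) λ F₂ →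
    (∀ X → Feasible F₁ X → X ⊆ P) ×
    (∀ X → Feasible F₂ X → X ⊆ ∁ P) ×
    IsDeltaMatroid F₁ × IsDeltaMatroid F₂ ×
    (∀ X → Feasible F X ⇔
       (∃[ X₁ ] ∃[ X₂ ] (Feasible F₁ X₁ × Feasible F₂ X₂ × X ≡ X₁ ∪ X₂)))

ConnectedDM : ∀ {n} → SetSystem n → Set
ConnectedDM F = ¬ IsDirectSumSplit F

-- U = E₀ ∪ E₁ ∪ E₂, skew class of e is {(e,0),(e,1),(e,2)}.
-- A transversal of Ω is encoded as τ : Vec (Fin 3) n (τ[e] = which copy
-- of e it contains); a subtransversal as σ : Vec (Maybe (Fin 3)) n.

Transversal : ℕ → Set
Transversal n = Vec (Fin 3) n

SubTransversal : ℕ → Set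
SubTransversal n = Vec (Maybe (Fin 3)) n

allTransversals : ∀ n → List (Transversal n)
allTransversals zero = [] ∷ []
allTransversals (suc n) =
  concatMap (λ i → L.map (i ∷_) (allTransversals n)) (allFin 3)

piCopy : ∀ {n} → Fin 3 → Transversal n → Subset n
piCopy k τ = map (λ i → ⌊ i ≟ k ⌋) τ

isBaseQ3 : ∀ {n} → SetSystem n → Transversal n → Bool
isBaseQ3 F τ = barTwist F (piCopy copy₂ τ) (piCopy copy₁ τ)
  where
  copy₁ copy₂ : Fin 3
  copy₁ = Data.Fin.suc Data.Fin.zero
  copy₂ = Data.Fin.suc (Data.Fin.suc Data.Fin.zero)

basesQ3 : ∀ {n} → SetSystem n → List (Transversal n)
basesQ3 F = filter (λ τ → Data.Bool._≟_ (isBaseQ3 F τ) true) (allTransversals _)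

agreeCount : ∀ {n} → SubTransversal n → Transversal n → ℕ
agreeCount [] [] = 0
agreeCount (nothing ∷ σ) (_ ∷ τ) = agreeCount σ τ
agreeCount (just i ∷ σ) (j ∷ τ) =
  (if ⌊ i ≟ j ⌋ then 1 else 0) + agreeCount σ τ

rankQ3 : ∀ {n} → SetSystem n → SubTransversal n → ℕ
rankQ3 F σ = foldr (λ τ m → agreeCount σ τ ⊔ m) 0 (basesQ3 F)

-- S ∩ X where X is the union of the skew classes of elements of P
restrict : ∀ {n} → Subset n → SubTransversal n → SubTransversal n
restrict P σ = zipWith (λ b m → if b then m else nothing) P σ

ConnectedQ3 : ∀ {n} → SetSystem n → Set
ConnectedQ3 {n} F =
  ¬ (Σ (Subset n) λ P → Nonempty P × Nonempty (∁ P) ×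
       (∀ (σ : SubTransversal n) →
          rankQ3 F σ ≡ rankQ3 F (restrict P σ) + rankQ3 F (restrict (∁ P) σ)))

module Submission where

-- Both kinds of disconnectedness are shown to be equivalent to one
-- combinatorial condition: for a non-trivial P ⊆ E, the feasible sets of D
-- are closed under "mixing along P" (taking X ∩ P together with Y − P).
--  * A direct sum along P is mix-closed; conversely a mix-closed
--    delta-matroid is the direct sum of its restrictions to P and ∁ P.
--  * Mix-closedness is equivalent to a factorisation D = D₁ ∧ D₂ with D₁
--    seeing only P and D₂ only ∁ P.  Twists and loop complementations
--    preserve such factorisations, hence so does D ↦ D \bar* A, so the
--    basis predicate of Q₃(D) factorises and its bases are mix-closed;
--    conversely Q₃(D) contains D via X ↦ X ∪ (E − X) copies.
--  * The rank of a multimatroid is additive along P exactly when its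
--    bases are mix-closed along P.
-- The file develops mixing of vectors, factorisations, their behaviour under
-- the operations defining \bar*, ranks, and direct sums, in that order.

open import Defs
open import Data.Bool using (Bool; true; false; _xor_; _∧_; if_then_else_)
import Data.Bool as Bool
open import Data.Bool.Properties
  using (T-≡; ∧-comm; ∧-assoc; ∧-identityʳ; ∨-identityʳ; ∧-distribʳ-xor; xor-identityʳ; xor-same)
open import Data.Empty using (⊥-elim)
open import Data.Fin using (Fin; zero; suc; _≟_)
open import Data.Fin.Subset using (Subset; _∈_; _∪_; _∩_; _─_; _⊆_; ∁; ⁅_⁆; ⊥; _-_; Nonempty)
open import Data.Fin.Subset.Properties
  using (drop-∷-⊆; p∩q⊆q; _⊆?_; _∈?_; x∈⁅y⁆⇒x≡y; x∈p∪q⁻; x∈p⇒x∉∁p; x∉p⇒x∈∁p)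
open import Data.List using (List; []; _∷_; foldr; allFin)
import Data.List as List
open import Data.List.Membership.Propositional using () renaming (_∈_ to _∈ˡ_)
open import Data.List.Membership.Propositional.Properties
  using (∈-allFin; ∈-map⁺; ∈-concatMap⁺; ∈-filter⁺; ∈-filter⁻)
open import Data.List.Relation.Unary.Any using (here; there)
import Data.List.Relation.Unary.Any as Any
open import Data.Maybe using (just; nothing)
open import Data.Nat using (ℕ; suc; _+_; _⊔_; _≤_; z≤n; s≤s)
open import Data.Nat.Properties
  using (+-assoc; +-mono-≤; ≤-antisym; ≤-total; ≤-pred; <⇒≱; m≤n⇒m≤1+n; m≤m⊔n; m≤n⇒m≤o⊔n;
         m≤n⇒m⊔n≡n; m≥n⇒m⊔n≡m; ⊔-identityʳ; +-commutativeSemigroup; module ≤-Reasoning)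
open import Algebra.Properties.CommutativeSemigroup +-commutativeSemigroup using (x∙yz≈y∙xz)
open import Data.Product using (Σ; ∃; ∃-syntax; _×_; _,_; proj₁; proj₂)
open import Data.Sum using (inj₁; inj₂)
open import Data.Vec using (Vec; []; _∷_; map; zipWith; lookup; here; there)
open import Data.Vec.Properties using (lookup-replicate)
open import Function.Base using (_∘_)
open import Function.Bundles using (_⇔_; mk⇔; Equivalence)
open import Relation.Binary.PropositionalEquality
open import Relation.Nullary using (Dec; yes; no)
open import Relation.Nullary.Decidable using (⌊_⌋; toWitness; fromWitness)

mix : ∀ {A : Set} {n} → Subset n → Vec A n → Vec A n → Vec A n
mix []      []       []       = []
mix (p ∷ P) (x ∷ xs) (y ∷ ys) = (if p then x else y) ∷ mix P xs ys

module _ {A : Set} where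

  mix-∁ : ∀ {n} (P : Subset n) (xs ys : Vec A n) → mix (∁ P) xs ys ≡ mix P ys xs
  mix-∁ []          []       []       = refl
  mix-∁ (true  ∷ P) (x ∷ xs) (y ∷ ys) = cong (y ∷_) (mix-∁ P xs ys)
  mix-∁ (false ∷ P) (x ∷ xs) (y ∷ ys) = cong (x ∷_) (mix-∁ P xs ys)

  mix-idem : ∀ {n} (P : Subset n) (xs : Vec A n) → mix P xs xs ≡ xs
  mix-idem []          []       = refl
  mix-idem (true  ∷ P) (x ∷ xs) = cong (x ∷_) (mix-idem P xs)
  mix-idem (false ∷ P) (x ∷ xs) = cong (x ∷_) (mix-idem P xs)

  mix-absorbˡ : ∀ {n} (P : Subset n) (xs ys zs : Vec A n) →
    mix P (mix P xs ys) zs ≡ mix P xs zs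
  mix-absorbˡ []          []       []       []       = refl
  mix-absorbˡ (true  ∷ P) (x ∷ xs) (y ∷ ys) (z ∷ zs) = cong (x ∷_) (mix-absorbˡ P xs ys zs)
  mix-absorbˡ (false ∷ P) (x ∷ xs) (y ∷ ys) (z ∷ zs) = cong (z ∷_) (mix-absorbˡ P xs ys zs)

  mix-absorbʳ : ∀ {n} (P : Subset n) (xs ys zs : Vec A n) →
    mix P xs (mix P ys zs) ≡ mix P xs zs
  mix-absorbʳ []          []       []       []       = refl
  mix-absorbʳ (true  ∷ P) (x ∷ xs) (y ∷ ys) (z ∷ zs) = cong (x ∷_) (mix-absorbʳ P xs ys zs)
  mix-absorbʳ (false ∷ P) (x ∷ xs) (y ∷ ys) (z ∷ zs) = cong (z ∷_) (mix-absorbʳ P xs ys zs)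

  mix-reassemble : ∀ {n} (P : Subset n) (xs ys zs : Vec A n) →
    mix P (mix P xs zs) (mix P zs ys) ≡ mix P xs ys
  mix-reassemble P xs ys zs = trans (mix-absorbˡ P xs zs _) (mix-absorbʳ P xs zs ys)

  map-mix : ∀ {B : Set} {n} (f : A → B) (P : Subset n) (xs ys : Vec A n) →
    map f (mix P xs ys) ≡ mix P (map f xs) (map f ys)
  map-mix f []          []       []       = refl
  map-mix f (true  ∷ P) (x ∷ xs) (y ∷ ys) = cong (f x ∷_) (map-mix f P xs ys)
  map-mix f (false ∷ P) (x ∷ xs) (y ∷ ys) = cong (f y ∷_) (map-mix f P xs ys)

  zipWith-mix : ∀ {n} (f : A → A → A) (P : Subset n) (xs ys us vs : Vec A n) →
    zipWith f (mix P xs ys) (mix P us vs) ≡ mix P (zipWith f xs us) (zipWith f ys vs)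
  zipWith-mix f []          []       []       []       []       = refl
  zipWith-mix f (true  ∷ P) (x ∷ xs) (y ∷ ys) (u ∷ us) (v ∷ vs) =
    cong (f x u ∷_) (zipWith-mix f P xs ys us vs)
  zipWith-mix f (false ∷ P) (x ∷ xs) (y ∷ ys) (u ∷ us) (v ∷ vs) =
    cong (f y v ∷_) (zipWith-mix f P xs ys us vs)

  lookup-mix-∈ : ∀ {n} {i : Fin n} {P : Subset n} (xs ys : Vec A n) → i ∈ P →
    lookup (mix P xs ys) i ≡ lookup xs i
  lookup-mix-∈ (x ∷ xs) (y ∷ ys) here      = refl
  lookup-mix-∈ (x ∷ xs) (y ∷ ys) (there i) = lookup-mix-∈ xs ys i

⊆-head : ∀ {n} {x : Bool} {X Q : Subset n} → (x ∷ X) ⊆ (false ∷ Q) → x ≡ false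
⊆-head {x = false} _ = refl
⊆-head {x = true}  h with h here
... | ()

mix-─ : ∀ {n} (P X Y R : Subset n) → R ⊆ P → mix P X Y ─ R ≡ mix P (X ─ R) Y
mix-─ []          []      []      []      _ = refl
mix-─ (true  ∷ P) (x ∷ X) (y ∷ Y) (r ∷ R) h = cong (_ ∷_) (mix-─ P X Y R (drop-∷-⊆ h))
mix-─ (false ∷ P) (x ∷ X) (y ∷ Y) (r ∷ R) h rewrite ⊆-head h =
  cong (y ∷_) (mix-─ P X Y R (drop-∷-⊆ h))

mix-△ : ∀ {n} (Q Z W S : Subset n) → S ⊆ Q → mix Q (Z △ S) W ≡ mix Q Z W △ S
mix-△ []          []      []      []      _ = refl
mix-△ (true  ∷ Q) (z ∷ Z) (w ∷ W) (s ∷ S) h = cong (_ ∷_) (mix-△ Q Z W S (drop-∷-⊆ h))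
mix-△ (false ∷ Q) (z ∷ Z) (w ∷ W) (s ∷ S) h rewrite ⊆-head h =
  cong₂ _∷_ (sym (xor-identityʳ w)) (mix-△ Q Z W S (drop-∷-⊆ h))

mix-△-common : ∀ {n} (Q X₁ X₂ Z : Subset n) → X₁ ⊆ Q → X₂ ⊆ Q →
  mix Q X₁ Z △ mix Q X₂ Z ≡ X₁ △ X₂
mix-△-common []          []        []        []      _  _  = refl
mix-△-common (true  ∷ Q) (x₁ ∷ X₁) (x₂ ∷ X₂) (z ∷ Z) h₁ h₂ =
  cong (_ ∷_) (mix-△-common Q X₁ X₂ Z (drop-∷-⊆ h₁) (drop-∷-⊆ h₂))
mix-△-common (false ∷ Q) (x₁ ∷ X₁) (x₂ ∷ X₂) (z ∷ Z) h₁ h₂ rewrite ⊆-head h₁ | ⊆-head h₂ =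
  cong₂ _∷_ (xor-same z) (mix-△-common Q X₁ X₂ Z (drop-∷-⊆ h₁) (drop-∷-⊆ h₂))

mix-∪ : ∀ {n} (P X Y : Subset n) → X ⊆ P → Y ⊆ ∁ P → mix P X Y ≡ X ∪ Y
mix-∪ []          []      []      _  _  = refl
mix-∪ (true  ∷ P) (x ∷ X) (y ∷ Y) hx hy rewrite ⊆-head hy =
  cong₂ _∷_ (sym (∨-identityʳ x)) (mix-∪ P X Y (drop-∷-⊆ hx) (drop-∷-⊆ hy))
mix-∪ (false ∷ P) (x ∷ X) (y ∷ Y) hx hy rewrite ⊆-head hx =
  cong (y ∷_) (mix-∪ P X Y (drop-∷-⊆ hx) (drop-∷-⊆ hy))

mix-∩ : ∀ {n} (Q X Y : Subset n) → mix Q (X ∩ Q) Y ≡ mix Q X Y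
mix-∩ []          []      []      = refl
mix-∩ (true  ∷ Q) (x ∷ X) (y ∷ Y) = cong₂ _∷_ (∧-identityʳ x) (mix-∩ Q X Y)
mix-∩ (false ∷ Q) (x ∷ X) (y ∷ Y) = cong (y ∷_) (mix-∩ Q X Y)

∩∪∩∁ : ∀ {n} (P X : Subset n) → X ≡ (X ∩ P) ∪ (X ∩ ∁ P)
∩∪∩∁ []          []          = refl
∩∪∩∁ (true  ∷ P) (true  ∷ X) = cong (true  ∷_) (∩∪∩∁ P X)
∩∪∩∁ (true  ∷ P) (false ∷ X) = cong (false ∷_) (∩∪∩∁ P X)
∩∪∩∁ (false ∷ P) (true  ∷ X) = cong (true  ∷_) (∩∪∩∁ P X)
∩∪∩∁ (false ∷ P) (false ∷ X) = cong (false ∷_) (∩∪∩∁ P X)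

△-⊆ : ∀ {n} {X Y Q : Subset n} → X ⊆ Q → Y ⊆ Q → X △ Y ⊆ Q
△-⊆ {X = true  ∷ X} {Y = false ∷ Y} hx hy here      = hx here
△-⊆ {X = false ∷ X} {Y = true  ∷ Y} hx hy here      = hy here
△-⊆ {X = _ ∷ X}     {Y = _ ∷ Y}     {_ ∷ Q} hx hy (there i) =
  there (△-⊆ (drop-∷-⊆ hx) (drop-∷-⊆ hy) i)

⁅⁆-⊆ : ∀ {n} {e : Fin n} {Q : Subset n} → e ∈ Q → ⁅ e ⁆ ⊆ Q
⁅⁆-⊆ {e = e} {Q} e∈Q i∈⁅e⁆ = subst (_∈ Q) (sym (x∈⁅y⁆⇒x≡y e i∈⁅e⁆)) e∈Q

⁅⁆∪⁅⁆-⊆ : ∀ {n} {x y : Fin n} {Q : Subset n} → x ∈ Q → y ∈ Q → ⁅ x ⁆ ∪ ⁅ y ⁆ ⊆ Q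
⁅⁆∪⁅⁆-⊆ {x = x} {y} x∈Q y∈Q i∈ with x∈p∪q⁻ ⁅ x ⁆ ⁅ y ⁆ i∈
... | inj₁ i∈⁅x⁆ = ⁅⁆-⊆ x∈Q i∈⁅x⁆
... | inj₂ i∈⁅y⁆ = ⁅⁆-⊆ y∈Q i∈⁅y⁆

DependsOn : ∀ {A : Set} {n} → Subset n → (Vec A n → Bool) → Set
DependsOn P h = ∀ xs ys → h (mix P xs ys) ≡ h xs

MixClosed : ∀ {A : Set} {n} → Subset n → (Vec A n → Bool) → Set
MixClosed P h = ∀ xs ys → h xs ≡ true → h ys ≡ true → h (mix P xs ys) ≡ true

record Factorisation {A : Set} {n} (P : Subset n) (h : Vec A n → Bool) : Set where
  field
    inner outer : Vec A n → Bool
    factor      : ∀ xs → h xs ≡ inner xs ∧ outer xs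
    inner-dep   : DependsOn P inner
    outer-dep   : DependsOn (∁ P) outer

∧-true : ∀ {a b} → a ∧ b ≡ true → a ≡ true × b ≡ true
∧-true {true} b≡true = refl , b≡true

module _ {A : Set} {n} {P : Subset n} {h : Vec A n → Bool} where

  factorisation⇒mixClosed : Factorisation P h → MixClosed P h
  factorisation⇒mixClosed fac xs ys hxs hys = begin
    h (mix P xs ys)                             ≡⟨ factor (mix P xs ys) ⟩
    inner (mix P xs ys) ∧ outer (mix P xs ys)   ≡⟨ cong₂ _∧_ (inner-dep xs ys) outer-mix ⟩
    inner xs ∧ outer ys                         ≡⟨ cong₂ _∧_ inner-xs outer-ys ⟩
    true                                        ∎
    where
    open Factorisation fac
    open ≡-Reasoning
    outer-mix : outer (mix P xs ys) ≡ outer ys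
    outer-mix = trans (cong outer (sym (mix-∁ P ys xs))) (outer-dep ys xs)
    inner-xs : inner xs ≡ true
    inner-xs = proj₁ (∧-true (trans (sym (factor xs)) hxs))
    outer-ys : outer ys ≡ true
    outer-ys = proj₂ (∧-true (trans (sym (factor ys)) hys))

  mixClosed⇒factorisation : ∀ x₀ → h x₀ ≡ true → MixClosed P h → Factorisation P h
  mixClosed⇒factorisation x₀ hx₀ closed = record
    { inner     = λ xs → h (mix P xs x₀)
    ; outer     = λ xs → h (mix P x₀ xs)
    ; factor    = factor
    ; inner-dep = λ xs ys → cong h (mix-absorbˡ P xs ys x₀)
    ; outer-dep = λ xs ys →
        cong h (trans (cong (mix P x₀) (mix-∁ P xs ys)) (mix-absorbʳ P x₀ ys xs))
    }
    where
    factor : ∀ xs → h xs ≡ h (mix P xs x₀) ∧ h (mix P x₀ xs)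
    factor xs with h xs in hxs
    ... | true rewrite closed xs x₀ hxs hx₀ | closed x₀ xs hx₀ hxs = refl
    ... | false with h (mix P xs x₀) in inner-true | h (mix P x₀ xs) in outer-true
    ...   | false | _     = refl
    ...   | true  | false = refl
    ...   | true  | true  = trans (sym hxs) (subst (λ zs → h zs ≡ true) reassemble
                              (closed _ _ inner-true outer-true))
      where
      reassemble : mix P (mix P xs x₀) (mix P x₀ xs) ≡ xs
      reassemble = trans (mix-reassemble P xs xs x₀) (mix-idem P xs)

-- A family of set systems indexed by the set A that is being twisted by.
Family : ℕ → Set
Family n = Subset n → SetSystem n

DependsOn₂ : ∀ {n} → Subset n → Family n → Set
DependsOn₂ P H = ∀ A A′ X X′ → H (mix P A A′) (mix P X X′) ≡ H A X

record Splitting {n} (P : Subset n) (H : Family n) : Set where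
  field
    inner outer : Family n
    factor      : ∀ A X → H A X ≡ inner A X ∧ outer A X
    inner-dep   : DependsOn₂ P inner
    outer-dep   : DependsOn₂ (∁ P) outer

twistF : ∀ {n} → Family n → Family n
twistF H A = twist (H A) A

stepF : ∀ {n} → Fin n → Family n → Family n
stepF e H A = if lookup A e then loopc (H A) e else H A

lcFamily : ∀ {n} → List (Fin n) → Family n → Family n
lcFamily l H A = foldr (λ e G → if lookup A e then loopc G e else G) (H A) l

-- barTwist F A is, by definition, barTwistF (λ _ → F) A.
barTwistF : ∀ {n} → Family n → Family n
barTwistF H = lcFamily (allFin _) (twistF (lcFamily (allFin _) H))

constant-splitting : ∀ {n} {P : Subset n} {G : SetSystem n} →
  Factorisation P G → Splitting P (λ _ → G)
constant-splitting fac = record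
  { inner     = λ _ → inner
  ; outer     = λ _ → outer
  ; factor    = λ _ → factor
  ; inner-dep = λ _ _ → inner-dep
  ; outer-dep = λ _ _ → outer-dep
  }
  where open Factorisation fac

twist-dep : ∀ {n} {Q : Subset n} {H : Family n} → DependsOn₂ Q H → DependsOn₂ Q (twistF H)
twist-dep {Q = Q} {H} dep A A′ X X′ = begin
  H (mix Q A A′) (mix Q X X′ △ mix Q A A′)   ≡⟨ cong (H _) (zipWith-mix _xor_ Q X X′ A A′) ⟩
  H (mix Q A A′) (mix Q (X △ A) (X′ △ A′))   ≡⟨ dep A A′ (X △ A) (X′ △ A′) ⟩
  H A (X △ A)                                ∎
  where open ≡-Reasoning

twist-splitting : ∀ {n} {P : Subset n} {H : Family n} → Splitting P H → Splitting P (twistF H)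
twist-splitting s = record
  { inner     = twistF inner
  ; outer     = twistF outer
  ; factor    = λ A X → factor A (X △ A)
  ; inner-dep = twist-dep inner-dep
  ; outer-dep = twist-dep outer-dep
  }
  where open Splitting s

remove-invariant : ∀ {n} {Q : Subset n} {H : Family n} {e : Fin n} →
  DependsOn₂ Q H → e ∈ ∁ Q → ∀ A X → H A (X - e) ≡ H A X
remove-invariant {Q = Q} {H} {e} dep e∈∁Q A X = begin
  H A (X - e)                     ≡⟨ cong₂ H (sym (mix-idem Q A)) X-e≡mix ⟩
  H (mix Q A A) (mix Q X (X - e)) ≡⟨ dep A A X (X - e) ⟩
  H A X                           ∎
  where
  open ≡-Reasoning
  X-e≡mix : X - e ≡ mix Q X (X - e)
  X-e≡mix = begin
    X - e                 ≡⟨ cong (_- e) (sym (mix-idem (∁ Q) X)) ⟩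
    mix (∁ Q) X X - e     ≡⟨ mix-─ (∁ Q) X X ⁅ e ⁆ (⁅⁆-⊆ e∈∁Q) ⟩
    mix (∁ Q) (X - e) X   ≡⟨ mix-∁ Q (X - e) X ⟩
    mix Q X (X - e)       ∎

step-dep : ∀ {n} {Q : Subset n} {H : Family n} {e : Fin n} →
  e ∈ Q → DependsOn₂ Q H → DependsOn₂ Q (stepF e H)
step-dep {Q = Q} {H} {e} e∈Q dep A A′ X X′ rewrite lookup-mix-∈ A A′ e∈Q with lookup A e
... | false = dep A A′ X X′
... | true  = cong₂ _xor_ (dep A A′ X X′) (cong₂ _∧_ (lookup-mix-∈ X X′ e∈Q) removed)
  where
  removed : H (mix Q A A′) (mix Q X X′ - e) ≡ H A (X - e)
  removed = trans (cong (H _) (mix-─ Q X X′ ⁅ e ⁆ (⁅⁆-⊆ e∈Q))) (dep A A′ (X - e) X′)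

loopc-factor : ∀ {n} {G G₁ G₂ : SetSystem n} {e : Fin n} →
  (∀ X → G X ≡ G₁ X ∧ G₂ X) → (∀ X → G₂ (X - e) ≡ G₂ X) →
  ∀ X → loopc G e X ≡ loopc G₁ e X ∧ G₂ X
loopc-factor {G = G} {G₁} {G₂} {e} fac inv X = begin
  G X xor (lookup X e ∧ G (X - e))
    ≡⟨ cong₂ (λ a b → a xor (lookup X e ∧ b)) (fac X)
             (trans (fac (X - e)) (cong (G₁ (X - e) ∧_) (inv X))) ⟩
  (G₁ X ∧ G₂ X) xor (lookup X e ∧ (G₁ (X - e) ∧ G₂ X))
    ≡⟨ cong ((G₁ X ∧ G₂ X) xor_) (sym (∧-assoc (lookup X e) (G₁ (X - e)) (G₂ X))) ⟩
  (G₁ X ∧ G₂ X) xor ((lookup X e ∧ G₁ (X - e)) ∧ G₂ X)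
    ≡⟨ sym (∧-distribʳ-xor (G₂ X) (G₁ X) (lookup X e ∧ G₁ (X - e))) ⟩
  (G₁ X xor (lookup X e ∧ G₁ (X - e))) ∧ G₂ X
    ∎
  where open ≡-Reasoning

if-factor : ∀ {n} (b : Bool) {G G₁ L L₁ M : SetSystem n} →
  (∀ X → G X ≡ G₁ X ∧ M X) → (∀ X → L X ≡ L₁ X ∧ M X) →
  ∀ X → (if b then L else G) X ≡ (if b then L₁ else G₁) X ∧ M X
if-factor true  _     facL = facL
if-factor false facG  _    = facG

step-factor : ∀ {n} {H K M : Family n} {e : Fin n} →
  (∀ A X → H A X ≡ K A X ∧ M A X) → (∀ A X → M A (X - e) ≡ M A X) →
  ∀ A X → stepF e H A X ≡ stepF e K A X ∧ M A X
step-factor {e = e} fac inv A = if-factor (lookup A e) (fac A) (loopc-factor (fac A) (inv A))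

step-splitting : ∀ {n} {P : Subset n} {H : Family n} (e : Fin n) →
  Splitting P H → Splitting P (stepF e H)
step-splitting {P = P} {H} e s with e ∈? P
... | yes e∈P = record
  { inner     = stepF e inner
  ; outer     = outer
  ; factor    = step-factor factor (remove-invariant outer-dep (x∉p⇒x∈∁p (x∈p⇒x∉∁p e∈P)))
  ; inner-dep = step-dep e∈P inner-dep
  ; outer-dep = outer-dep
  }
  where open Splitting s
... | no e∉P = record
  { inner     = inner
  ; outer     = stepF e outer
  ; factor    = λ A X → trans (step-factor swapped (remove-invariant inner-dep e∈∁P) A X)
                              (∧-comm (stepF e outer A X) (inner A X))
  ; inner-dep = inner-dep
  ; outer-dep = step-dep e∈∁P outer-dep
  }
  where
  open Splitting s
  e∈∁P : e ∈ ∁ P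
  e∈∁P = x∉p⇒x∈∁p e∉P
  swapped : ∀ A X → H A X ≡ outer A X ∧ inner A X
  swapped A X = trans (factor A X) (∧-comm (inner A X) (outer A X))

lcFamily-splitting : ∀ {n} {P : Subset n} {H : Family n} (l : List (Fin n)) →
  Splitting P H → Splitting P (lcFamily l H)
lcFamily-splitting []      s = s
lcFamily-splitting (e ∷ l) s = step-splitting e (lcFamily-splitting l s)

barTwist-splitting : ∀ {n} {P : Subset n} {H : Family n} →
  Splitting P H → Splitting P (barTwistF H)
barTwist-splitting s =
  lcFamily-splitting (allFin _) (twist-splitting (lcFamily-splitting (allFin _) s))

copies-factorisation : ∀ {n} {P : Subset n} {H : Family n} → Splitting P H →
  ∀ (k₁ k₂ : Fin 3) → Factorisation P (λ τ → H (piCopy k₂ τ) (piCopy k₁ τ))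
copies-factorisation {P = P} s k₁ k₂ = record
  { inner     = λ τ → inner (piCopy k₂ τ) (piCopy k₁ τ)
  ; outer     = λ τ → outer (piCopy k₂ τ) (piCopy k₁ τ)
  ; factor    = λ τ → factor (piCopy k₂ τ) (piCopy k₁ τ)
  ; inner-dep = λ τ τ′ → through-copies P inner-dep τ τ′
  ; outer-dep = λ τ τ′ → through-copies (∁ P) outer-dep τ τ′
  }
  where
  open Splitting s
  through-copies : ∀ Q {K} → DependsOn₂ Q K → ∀ τ τ′ →
    K (piCopy k₂ (mix Q τ τ′)) (piCopy k₁ (mix Q τ τ′)) ≡ K (piCopy k₂ τ) (piCopy k₁ τ)
  through-copies Q {K} dep τ τ′ =
    trans (cong₂ K (map-mix _ Q τ τ′) (map-mix _ Q τ τ′)) (dep _ _ _ _)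

bases-factorisation : ∀ {n} {P : Subset n} {F : SetSystem n} →
  Factorisation P F → Factorisation P (isBaseQ3 F)
bases-factorisation fac =
  copies-factorisation (barTwist-splitting (constant-splitting fac)) (suc zero) (suc (suc zero))

embed : ∀ {n} → Subset n → Transversal n
embed = map (λ b → if b then suc zero else zero)

embed-copy₁ : ∀ {n} (X : Subset n) → piCopy (suc zero) (embed X) ≡ X
embed-copy₁ []          = refl
embed-copy₁ (true  ∷ X) = cong (true  ∷_) (embed-copy₁ X)
embed-copy₁ (false ∷ X) = cong (false ∷_) (embed-copy₁ X)

embed-copy₂ : ∀ {n} (X : Subset n) → piCopy (suc (suc zero)) (embed X) ≡ ⊥
embed-copy₂ []          = refl
embed-copy₂ (true  ∷ X) = cong (false ∷_) (embed-copy₂ X)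
embed-copy₂ (false ∷ X) = cong (false ∷_) (embed-copy₂ X)

lcFamily-⊥ : ∀ {n} (l : List (Fin n)) (H : Family n) → lcFamily l H ⊥ ≡ H ⊥
lcFamily-⊥ []      H = refl
lcFamily-⊥ (e ∷ l) H rewrite lookup-replicate e false = lcFamily-⊥ l H

△-⊥ : ∀ {n} (X : Subset n) → X △ ⊥ ≡ X
△-⊥ []      = refl
△-⊥ (x ∷ X) = cong₂ _∷_ (xor-identityʳ x) (△-⊥ X)

-- Since D \bar* ∅ = D, the embedded transversal of X is a basis of Q₃(D)
-- exactly when X is feasible.
isBase-embed : ∀ {n} (F : SetSystem n) (X : Subset n) → isBaseQ3 F (embed X) ≡ F X
isBase-embed {n} F X rewrite embed-copy₁ X | embed-copy₂ X = begin
  barTwistF (λ _ → F) ⊥ X  ≡⟨ cong (λ G → G X) (lcFamily-⊥ (allFin n) (twistF loopcs)) ⟩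
  loopcs ⊥ (X △ ⊥)         ≡⟨ cong (λ G → G (X △ ⊥)) (lcFamily-⊥ (allFin n) (λ _ → F)) ⟩
  F (X △ ⊥)                ≡⟨ cong F (△-⊥ X) ⟩
  F X                      ∎
  where
  open ≡-Reasoning
  loopcs : Family n
  loopcs = lcFamily (allFin n) (λ _ → F)

feasible⇒bases-mixClosed : ∀ {n} {P : Subset n} {F : SetSystem n} X₀ → F X₀ ≡ true →
  MixClosed P F → MixClosed P (isBaseQ3 F)
feasible⇒bases-mixClosed X₀ FX₀ closed =
  factorisation⇒mixClosed (bases-factorisation (mixClosed⇒factorisation X₀ FX₀ closed))

bases⇒feasible-mixClosed : ∀ {n} {P : Subset n} {F : SetSystem n} →
  MixClosed P (isBaseQ3 F) → MixClosed P F
bases⇒feasible-mixClosed {P = P} {F} closed X Y FX FY = begin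
  F (mix P X Y)                           ≡⟨ sym (isBase-embed F (mix P X Y)) ⟩
  isBaseQ3 F (embed (mix P X Y))          ≡⟨ cong (isBaseQ3 F) (map-mix _ P X Y) ⟩
  isBaseQ3 F (mix P (embed X) (embed Y))  ≡⟨ closed (embed X) (embed Y) (basis X FX) (basis Y FY) ⟩
  true                                    ∎
  where
  open ≡-Reasoning
  basis : ∀ Z → F Z ≡ true → isBaseQ3 F (embed Z) ≡ true
  basis Z FZ = trans (isBase-embed F Z) FZ

-- The maximum of f over a list, 0 for the empty list; by definition
-- rankQ3 F σ = maxOver (agreeCount σ) (basesQ3 F).
maxOver : ∀ {A : Set} → (A → ℕ) → List A → ℕ
maxOver f = foldr (λ x m → f x ⊔ m) 0

maxOver-ub : ∀ {A : Set} (f : A → ℕ) {x : A} {l : List A} → x ∈ˡ l → f x ≤ maxOver f l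
maxOver-ub f {l = y ∷ l} (here refl) = m≤m⊔n (f y) (maxOver f l)
maxOver-ub f {l = y ∷ l} (there x∈l) = m≤n⇒m≤o⊔n (f y) (maxOver-ub f x∈l)

maxOver-attained : ∀ {A : Set} (f : A → ℕ) {x : A} (l : List A) → x ∈ˡ l →
  ∃ λ y → y ∈ˡ l × f y ≡ maxOver f l
maxOver-attained f (y ∷ [])     _ = y , here refl , sym (⊔-identityʳ (f y))
maxOver-attained f (y ∷ y′ ∷ l) _
  with maxOver-attained f (y′ ∷ l) (here refl) | ≤-total (f y) (maxOver f (y′ ∷ l))
... | z , z∈ , fz≡max | inj₁ fy≤max = z , there z∈ , trans fz≡max (sym (m≤n⇒m⊔n≡n fy≤max))
... | _ , _  , _      | inj₂ max≤fy = y , here refl , sym (m≥n⇒m⊔n≡m max≤fy)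

hit : Fin 3 → Fin 3 → ℕ
hit i j = if ⌊ i ≟ j ⌋ then 1 else 0

agree-split : ∀ {n} (P : Subset n) (σ : SubTransversal n) (τ : Transversal n) →
  agreeCount σ τ ≡ agreeCount (restrict P σ) τ + agreeCount (restrict (∁ P) σ) τ
agree-split []          []            []      = refl
agree-split (true  ∷ P) (nothing ∷ σ) (j ∷ τ) = agree-split P σ τ
agree-split (false ∷ P) (nothing ∷ σ) (j ∷ τ) = agree-split P σ τ
agree-split (true  ∷ P) (just i ∷ σ)  (j ∷ τ) =
  trans (cong (hit i j +_) (agree-split P σ τ))
        (sym (+-assoc (hit i j) (agreeCount (restrict P σ) τ) (agreeCount (restrict (∁ P) σ) τ)))
agree-split (false ∷ P) (just i ∷ σ)  (j ∷ τ) =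
  trans (cong (hit i j +_) (agree-split P σ τ))
        (x∙yz≈y∙xz (hit i j) (agreeCount (restrict P σ) τ) (agreeCount (restrict (∁ P) σ) τ))

agree-mix : ∀ {n} (P : Subset n) (σ : SubTransversal n) (τ₁ τ₂ : Transversal n) →
  agreeCount (restrict P σ) (mix P τ₁ τ₂) ≡ agreeCount (restrict P σ) τ₁
agree-mix []          []            []        []        = refl
agree-mix (true  ∷ P) (nothing ∷ σ) (a ∷ τ₁) (b ∷ τ₂) = agree-mix P σ τ₁ τ₂
agree-mix (true  ∷ P) (just i ∷ σ)  (a ∷ τ₁) (b ∷ τ₂) = cong (hit i a +_) (agree-mix P σ τ₁ τ₂)
agree-mix (false ∷ P) (m ∷ σ)       (a ∷ τ₁) (b ∷ τ₂) = agree-mix P σ τ₁ τ₂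

agree-mix-∁ : ∀ {n} (P : Subset n) (σ : SubTransversal n) (τ₁ τ₂ : Transversal n) →
  agreeCount (restrict (∁ P) σ) (mix P τ₁ τ₂) ≡ agreeCount (restrict (∁ P) σ) τ₂
agree-mix-∁ P σ τ₁ τ₂ =
  trans (cong (agreeCount (restrict (∁ P) σ)) (sym (mix-∁ P τ₂ τ₁))) (agree-mix (∁ P) σ τ₂ τ₁)

agree-self : ∀ {n} (τ : Transversal n) → agreeCount (map just τ) τ ≡ n
agree-self []      = refl
agree-self (i ∷ τ) with i ≟ i
... | yes _  = cong suc (agree-self τ)
... | no i≢i = ⊥-elim (i≢i refl)

agree-≤ : ∀ {n} (σ : SubTransversal n) (τ : Transversal n) → agreeCount σ τ ≤ n
agree-≤ []            []      = z≤n
agree-≤ (nothing ∷ σ) (j ∷ τ) = m≤n⇒m≤1+n (agree-≤ σ τ)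
agree-≤ (just i ∷ σ)  (j ∷ τ) with i ≟ j
... | yes _ = s≤s (agree-≤ σ τ)
... | no _  = m≤n⇒m≤1+n (agree-≤ σ τ)

agree-full : ∀ {n} (τ τ′ : Transversal n) → n ≤ agreeCount (map just τ) τ′ → τ ≡ τ′
agree-full []      []        _ = refl
agree-full (i ∷ τ) (j ∷ τ′) n≤ with i ≟ j
... | yes refl = cong (i ∷_) (agree-full τ τ′ (≤-pred n≤))
... | no _     = ⊥-elim (<⇒≱ (s≤s (agree-≤ (map just τ) τ′)) n≤)

rankOver : ∀ {n} → List (Transversal n) → SubTransversal n → ℕ
rankOver B σ = maxOver (agreeCount σ) B

RankAdditive : ∀ {n} → Subset n → List (Transversal n) → Set
RankAdditive P B = ∀ σ → rankOver B σ ≡ rankOver B (restrict P σ) + rankOver B (restrict (∁ P) σ)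

MixClosedList : ∀ {n} → Subset n → List (Transversal n) → Set
MixClosedList P B = ∀ {τ₁ τ₂} → τ₁ ∈ˡ B → τ₂ ∈ˡ B → mix P τ₁ τ₂ ∈ˡ B

-- A mix-closed set of bases has a rank function that is additive along P:
-- optimal bases for the two halves of S combine into one basis.
mixClosed⇒rankAdditive : ∀ {n} {P : Subset n} (B : List (Transversal n)) →
  MixClosedList P B → RankAdditive P B
mixClosed⇒rankAdditive             []      closed σ = refl
mixClosed⇒rankAdditive {P = P} B@(_ ∷ _) closed σ
  with maxOver-attained (agreeCount σ) B (here refl)
     | maxOver-attained (agreeCount (restrict P σ)) B (here refl)
     | maxOver-attained (agreeCount (restrict (∁ P) σ)) B (here refl)
... | τ , τ∈ , τ-max | τ₁ , τ₁∈ , τ₁-max | τ₂ , τ₂∈ , τ₂-max = ≤-antisym split≤ combine≤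
  where
  open ≤-Reasoning
  σ₁ = restrict P σ
  σ₂ = restrict (∁ P) σ
  split≤ : rankOver B σ ≤ rankOver B σ₁ + rankOver B σ₂
  split≤ = begin
    rankOver B σ                            ≡⟨ sym τ-max ⟩
    agreeCount σ τ                          ≡⟨ agree-split P σ τ ⟩
    agreeCount σ₁ τ + agreeCount σ₂ τ       ≤⟨ +-mono-≤ (maxOver-ub (agreeCount σ₁) τ∈)
                                                        (maxOver-ub (agreeCount σ₂) τ∈) ⟩
    rankOver B σ₁ + rankOver B σ₂           ∎
  combine≤ : rankOver B σ₁ + rankOver B σ₂ ≤ rankOver B σ
  combine≤ = begin
    rankOver B σ₁ + rankOver B σ₂           ≡⟨ cong₂ _+_ (sym τ₁-max) (sym τ₂-max) ⟩
    agreeCount σ₁ τ₁ + agreeCount σ₂ τ₂     ≡⟨ cong₂ _+_ (sym (agree-mix P σ τ₁ τ₂))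
                                                         (sym (agree-mix-∁ P σ τ₁ τ₂)) ⟩
    agreeCount σ₁ (mix P τ₁ τ₂) + agreeCount σ₂ (mix P τ₁ τ₂)
                                            ≡⟨ sym (agree-split P σ (mix P τ₁ τ₂)) ⟩
    agreeCount σ (mix P τ₁ τ₂)              ≤⟨ maxOver-ub (agreeCount σ) (closed τ₁∈ τ₂∈) ⟩
    rankOver B σ                            ∎

-- Conversely, if the rank is additive along P then the mix τ of two bases is
-- a basis: the full subtransversal of τ has rank n, so some basis agrees with
-- τ in every skew class.
rankAdditive⇒mixClosed : ∀ {n} {P : Subset n} (B : List (Transversal n)) →
  RankAdditive P B → MixClosedList P B
rankAdditive⇒mixClosed {n} {P} B additive {τ₁} {τ₂} τ₁∈ τ₂∈
  with maxOver-attained (agreeCount (map just (mix P τ₁ τ₂))) B τ₁∈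
... | τ′ , τ′∈ , τ′-max = subst (_∈ˡ B) (sym (agree-full τ τ′ n≤agree)) τ′∈
  where
  open ≤-Reasoning
  τ = mix P τ₁ τ₂
  σ = map just τ
  σ₁ = restrict P σ
  σ₂ = restrict (∁ P) σ
  n≤agree : n ≤ agreeCount σ τ′
  n≤agree = begin
    n                                   ≡⟨ sym (agree-self τ) ⟩
    agreeCount σ τ                      ≡⟨ agree-split P σ τ ⟩
    agreeCount σ₁ τ + agreeCount σ₂ τ   ≡⟨ cong₂ _+_ (agree-mix P σ τ₁ τ₂) (agree-mix-∁ P σ τ₁ τ₂) ⟩
    agreeCount σ₁ τ₁ + agreeCount σ₂ τ₂ ≤⟨ +-mono-≤ (maxOver-ub (agreeCount σ₁) τ₁∈)
                                                    (maxOver-ub (agreeCount σ₂) τ₂∈) ⟩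
    rankOver B σ₁ + rankOver B σ₂       ≡⟨ sym (additive σ) ⟩
    rankOver B σ                        ≡⟨ sym τ′-max ⟩
    agreeCount σ τ′                     ∎

∈-allTransversals : ∀ {n} (τ : Transversal n) → τ ∈ˡ allTransversals n
∈-allTransversals []              = here refl
∈-allTransversals {suc n} (i ∷ τ) =
  ∈-concatMap⁺ (λ j → List.map (j ∷_) (allTransversals n))
    (Any.map (λ { refl → ∈-map⁺ (i ∷_) (∈-allTransversals τ) }) (∈-allFin i))

∈-bases⇔ : ∀ {n} (F : SetSystem n) (τ : Transversal n) → τ ∈ˡ basesQ3 F ⇔ isBaseQ3 F τ ≡ true
∈-bases⇔ F τ = mk⇔
  (λ τ∈ → proj₂ (∈-filter⁻ accepts? {xs = allTransversals _} τ∈))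
  (∈-filter⁺ accepts? (∈-allTransversals τ))
  where
  accepts? : ∀ τ → Dec (isBaseQ3 F τ ≡ true)
  accepts? τ = isBaseQ3 F τ Bool.≟ true

q3-rankAdditive⇔ : ∀ {n} (F : SetSystem n) (P : Subset n) →
  (∀ σ → rankQ3 F σ ≡ rankQ3 F (restrict P σ) + rankQ3 F (restrict (∁ P) σ)) ⇔
  MixClosed P (isBaseQ3 F)
q3-rankAdditive⇔ F P = mk⇔
  (λ additive τ₁ τ₂ b₁ b₂ → to (rankAdditive⇒mixClosed (basesQ3 F) additive (from b₁) (from b₂)))
  (λ closed → mixClosed⇒rankAdditive (basesQ3 F) λ τ₁∈ τ₂∈ → from (closed _ _ (to τ₁∈) (to τ₂∈)))
  where
  to : ∀ {τ} → τ ∈ˡ basesQ3 F → isBaseQ3 F τ ≡ true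
  to {τ} = Equivalence.to (∈-bases⇔ F τ)
  from : ∀ {τ} → isBaseQ3 F τ ≡ true → τ ∈ˡ basesQ3 F
  from {τ} = Equivalence.from (∈-bases⇔ F τ)

-- A direct sum along P is closed under mixing along P: mixing X₁ ∪ X₂ with
-- Y₁ ∪ Y₂ gives X₁ ∪ Y₂.
directSum⇒mixClosed : ∀ {n} {F : SetSystem n} (P : Subset n) (F₁ F₂ : SetSystem n) →
  (∀ X → Feasible F₁ X → X ⊆ P) → (∀ X → Feasible F₂ X → X ⊆ ∁ P) →
  (∀ X → Feasible F X ⇔ (∃[ X₁ ] ∃[ X₂ ] (Feasible F₁ X₁ × Feasible F₂ X₂ × X ≡ X₁ ∪ X₂))) →
  MixClosed P F
directSum⇒mixClosed {F = F} P F₁ F₂ inside outside sum X Y FX FY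
  with Equivalence.to (sum X) FX | Equivalence.to (sum Y) FY
... | X₁ , X₂ , FX₁ , FX₂ , refl | Y₁ , Y₂ , FY₁ , FY₂ , refl =
  subst (λ Z → F Z ≡ true) (sym mixed)
    (Equivalence.from (sum (X₁ ∪ Y₂)) (X₁ , Y₂ , FX₁ , FY₂ , refl))
  where
  open ≡-Reasoning
  mixed : mix P (X₁ ∪ X₂) (Y₁ ∪ Y₂) ≡ X₁ ∪ Y₂
  mixed = begin
    mix P (X₁ ∪ X₂) (Y₁ ∪ Y₂)
      ≡⟨ sym (cong₂ (mix P) (mix-∪ P X₁ X₂ (inside X₁ FX₁) (outside X₂ FX₂))
                            (mix-∪ P Y₁ Y₂ (inside Y₁ FY₁) (outside Y₂ FY₂))) ⟩
    mix P (mix P X₁ X₂) (mix P Y₁ Y₂)  ≡⟨ mix-absorbˡ P X₁ X₂ _ ⟩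
    mix P X₁ (mix P Y₁ Y₂)             ≡⟨ mix-absorbʳ P X₁ Y₁ Y₂ ⟩
    mix P X₁ Y₂                        ≡⟨ mix-∪ P X₁ Y₂ (inside X₁ FX₁) (outside Y₂ FY₂) ⟩
    X₁ ∪ Y₂                            ∎

restrictTo : ∀ {n} → Subset n → Subset n → SetSystem n → SetSystem n
restrictTo Q X₀ F X = F (mix Q X X₀) ∧ ⌊ X ⊆? Q ⌋

module _ {n} {Q X₀ : Subset n} {F : SetSystem n} where

  restrictTo-intro : ∀ {X} → F (mix Q X X₀) ≡ true → X ⊆ Q → Feasible (restrictTo Q X₀ F) X
  restrictTo-intro {X} FX X⊆Q rewrite FX =
    Equivalence.to T-≡ (fromWitness {a? = X ⊆? Q} (λ {x} → X⊆Q {x}))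

  restrictTo-elim : ∀ {X} → Feasible (restrictTo Q X₀ F) X → F (mix Q X X₀) ≡ true × X ⊆ Q
  restrictTo-elim {X} feasible with ∧-true {F (mix Q X X₀)} feasible
  ... | FX , X⊆Q? = FX , toWitness (Equivalence.from T-≡ X⊆Q?)

  -- If F is a delta-matroid with feasible X₀, then so is its restriction to Q:
  -- completion by X₀ turns symmetric differences inside Q into symmetric
  -- differences of feasible sets of F.
  restrictTo-deltaMatroid : IsDeltaMatroid F → F X₀ ≡ true → IsDeltaMatroid (restrictTo Q X₀ F)
  restrictTo-deltaMatroid (_ , exchange) FX₀ = (X₀ ∩ Q , nonempty) , exchange′
    where
    nonempty : Feasible (restrictTo Q X₀ F) (X₀ ∩ Q)
    nonempty = restrictTo-intro (trans (cong F (trans (mix-∩ Q X₀ X₀) (mix-idem Q X₀))) FX₀)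
                                (p∩q⊆q X₀ Q)
    exchange′ : ∀ X₁ X₂ → Feasible (restrictTo Q X₀ F) X₁ → Feasible (restrictTo Q X₀ F) X₂ →
      ∀ x → x ∈ (X₁ △ X₂) →
      ∃[ y ] (y ∈ (X₁ △ X₂) × Feasible (restrictTo Q X₀ F) (X₁ △ (⁅ x ⁆ ∪ ⁅ y ⁆)))
    exchange′ X₁ X₂ feasible₁ feasible₂ x x∈
      with restrictTo-elim feasible₁ | restrictTo-elim feasible₂
    ... | FX₁ , X₁⊆Q | FX₂ , X₂⊆Q
      with exchange (mix Q X₁ X₀) (mix Q X₂ X₀) FX₁ FX₂ x (subst (x ∈_) (sym same-△) x∈)
      where
      same-△ : mix Q X₁ X₀ △ mix Q X₂ X₀ ≡ X₁ △ X₂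
      same-△ = mix-△-common Q X₁ X₂ X₀ X₁⊆Q X₂⊆Q
    ... | y , y∈ , F-exchanged = y , y∈′ , restrictTo-intro F-exchanged′ (△-⊆ X₁⊆Q S⊆Q)
      where
      y∈′ : y ∈ (X₁ △ X₂)
      y∈′ = subst (y ∈_) (mix-△-common Q X₁ X₂ X₀ X₁⊆Q X₂⊆Q) y∈
      S⊆Q : ⁅ x ⁆ ∪ ⁅ y ⁆ ⊆ Q
      S⊆Q = ⁅⁆∪⁅⁆-⊆ (△-⊆ X₁⊆Q X₂⊆Q x∈) (△-⊆ X₁⊆Q X₂⊆Q y∈′)
      F-exchanged′ : F (mix Q (X₁ △ (⁅ x ⁆ ∪ ⁅ y ⁆)) X₀) ≡ true
      F-exchanged′ = trans (cong F (mix-△ Q X₁ X₀ _ S⊆Q)) F-exchanged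

MixSplit : ∀ {n} → SetSystem n → Set
MixSplit {n} F = Σ (Subset n) λ P → Nonempty P × Nonempty (∁ P) × MixClosed P F

Q3Split : ∀ {n} → SetSystem n → Set
Q3Split {n} F = Σ (Subset n) λ P → Nonempty P × Nonempty (∁ P) ×
  (∀ σ → rankQ3 F σ ≡ rankQ3 F (restrict P σ) + rankQ3 F (restrict (∁ P) σ))

directSum⇔mixSplit : ∀ {n} {F : SetSystem n} → IsDeltaMatroid F → IsDirectSumSplit F ⇔ MixSplit F
directSum⇔mixSplit {n} {F} dm@((X₀ , FX₀) , _) = mk⇔
  (λ (P , neP , neC , F₁ , F₂ , inside , outside , _ , _ , sum) →
     P , neP , neC , directSum⇒mixClosed P F₁ F₂ inside outside sum)
  (λ (P , neP , neC , closed) →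
     P , neP , neC , restrictTo P X₀ F , restrictTo (∁ P) X₀ F ,
     (λ _ → proj₂ ∘ restrictTo-elim {Q = P} {X₀} {F}) ,
     (λ _ → proj₂ ∘ restrictTo-elim {Q = ∁ P} {X₀} {F}) ,
     restrictTo-deltaMatroid dm FX₀ , restrictTo-deltaMatroid dm FX₀ ,
     decompose P closed)
  where
  Decomposed : Subset n → Subset n → Set
  Decomposed P X = ∃[ X₁ ] ∃[ X₂ ] (Feasible (restrictTo P X₀ F) X₁ ×
                                    Feasible (restrictTo (∁ P) X₀ F) X₂ × X ≡ X₁ ∪ X₂)
  decompose : ∀ P → MixClosed P F → ∀ X → Feasible F X ⇔ Decomposed P X
  decompose P closed X = mk⇔ split join
    where
    closed∁ : MixClosed (∁ P) F
    closed∁ X Y FX FY = subst (λ Z → F Z ≡ true) (sym (mix-∁ P X Y)) (closed Y X FY FX)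
    part : ∀ Q → MixClosed Q F → Feasible F X → Feasible (restrictTo Q X₀ F) (X ∩ Q)
    part Q closedQ FX = restrictTo-intro {Q = Q} {X₀} {F}
      (trans (cong F (mix-∩ Q X X₀)) (closedQ X X₀ FX FX₀)) (p∩q⊆q X Q)
    split : Feasible F X → Decomposed P X
    split FX = X ∩ P , X ∩ ∁ P , part P closed FX , part (∁ P) closed∁ FX , ∩∪∩∁ P X
    join : Decomposed P X → Feasible F X
    join (X₁ , X₂ , feasible₁ , feasible₂ , refl)
      with restrictTo-elim {Q = P} {X₀} {F} feasible₁
         | restrictTo-elim {Q = ∁ P} {X₀} {F} feasible₂
    ... | FX₁ , X₁⊆P | FX₂ , X₂⊆∁P =
      subst (λ Z → F Z ≡ true) (trans (mix-reassemble P X₁ X₂ X₀) (mix-∪ P X₁ X₂ X₁⊆P X₂⊆∁P))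
        (closed _ _ FX₁ (subst (λ Z → F Z ≡ true) (mix-∁ P X₂ X₀) FX₂))

q3Split⇔mixSplit : ∀ {n} {F : SetSystem n} {X₀ : Subset n} → F X₀ ≡ true → Q3Split F ⇔ MixSplit F
q3Split⇔mixSplit {F = F} {X₀} FX₀ = mk⇔
  (λ (P , neP , neC , additive) →
     P , neP , neC , bases⇒feasible-mixClosed (Equivalence.to (q3-rankAdditive⇔ F P) additive))
  (λ (P , neP , neC , closed) →
     P , neP , neC ,
     Equivalence.from (q3-rankAdditive⇔ F P) (feasible⇒bases-mixClosed X₀ FX₀ closed))

proposition21 : ∀ {n : ℕ} (F : SetSystem n) → VFSafe F →
    (ConnectedDM F ⇔ ConnectedQ3 F)
proposition21 F vfSafe = mk⇔
  (λ connected split → connected (Equivalence.from dmSplit (Equivalence.to q3Split split)))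
  (λ connected split → connected (Equivalence.from q3Split (Equivalence.to dmSplit split)))
  where
  dm : IsDeltaMatroid F
  dm = vfSafe []
  dmSplit : IsDirectSumSplit F ⇔ MixSplit F
  dmSplit = directSum⇔mixSplit dm
  q3Split : Q3Split F ⇔ MixSplit F
  q3Split = q3Split⇔mixSplit (proj₂ (proj₁ dm))
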